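{- For every multiset $B=\{b_1,\ldots,b_m\}$ of positive integers, the graph $G_B$ is nonempty, connected, and has diameter at most $2m$.
   Context: $[n]_q=1+q+\cdots+q^{n-1}$. A basic cyclotomic generating function is a polynomial with nonnegative integer coefficients of the form $\prod_{j=1}^m[a_j]_q/[b_j]_q$ for multisets of positive integers. $G_B$ is the graph whose vertices are the multisets $\{a_1,\ldots,a_m\}$ of positive integers for which $\prod_{k=1}^m[a_k]_q/[b_k]_q$ is a basic cyclotomic generating function, with two vertices adjacent if the multisets differ in a single element. -}

module Defs where

open import Data.Nat using (ℕ; zero; suc; _+_; _*_; _≤_; _<_)
open import Data.List using (List; []; _∷_; replicate; length)
open import Data.List.Relation.Unary.All using (All)
open import Data.List.Relation.Binary.Permutation.Propositional using (_↭_)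
open import Data.Product using (Σ; ∃; _×_; _,_)
open import Relation.Binary.PropositionalEquality using (_≡_; _≢_)

-- Polynomials with natural-number coefficients, as coefficient lists
-- (constant term first).  Trailing zeros are allowed; equality of
-- polynomials is coefficientwise (see _≈ₚ_).
Poly : Set
Poly = List ℕ

coeff : Poly → ℕ → ℕ
coeff []       _       = 0
coeff (c ∷ p)  zero    = c
coeff (c ∷ p)  (suc k) = coeff p k

_≈ₚ_ : Poly → Poly → Set
p ≈ₚ q = ∀ k → coeff p k ≡ coeff q k

_+ₚ_ : Poly → Poly → Poly
[]      +ₚ q       = q
(a ∷ p) +ₚ []      = a ∷ p
(a ∷ p) +ₚ (b ∷ q) = (a + b) ∷ (p +ₚ q)

scale : ℕ → Poly → Poly
scale a []      = []
scale a (b ∷ p) = (a * b) ∷ scale a p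

_*ₚ_ : Poly → Poly → Poly
[]      *ₚ q = []
(a ∷ p) *ₚ q = scale a q +ₚ (0 ∷ (p *ₚ q))

-- q-integer [n]_q = 1 + q + ... + q^(n-1)
qint : ℕ → Poly
qint n = replicate n 1

qprod : List ℕ → Poly
qprod []       = 1 ∷ []
qprod (a ∷ as) = qint a *ₚ qprod as

-- a multiset of positive integers (represented by a list, up to ↭)
Positive : List ℕ → Set
Positive = All (λ n → 0 < n)

-- ∏[a_j]_q / ∏[b_j]_q is a polynomial with nonnegative integer
-- coefficients: there is c ∈ ℕ[q] with ∏[b_j]_q · c = ∏[a_j]_q.
IsBCGF : List ℕ → List ℕ → Set
IsBCGF A B = Σ Poly λ c → (qprod B *ₚ c) ≈ₚ qprod A

Vertex : List ℕ → List ℕ → Set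
Vertex B A = Positive A × (length A ≡ length B) × IsBCGF A B

-- multisets differing in a single element
Adjacent : List ℕ → List ℕ → Set
Adjacent A A' = Σ ℕ λ x → Σ ℕ λ y → Σ (List ℕ) λ rest →
  x ≢ y × (A ↭ (x ∷ rest)) × (A' ↭ (y ∷ rest))

-- Path B A A' n : a walk of length n in G_B from A to A' (multisets,
-- so the endpoint is reached up to permutation); every vertex visited
-- after the start lies in G_B.
data Path (B : List ℕ) : List ℕ → List ℕ → ℕ → Set where
  stay : ∀ {A A'} → A ↭ A' → Path B A A' 0
  step : ∀ {A A'' C n} → Adjacent A A'' → Vertex B A'' →
         Path B A'' C n → Path B A C (suc n)

module Submission where

-- Since [K t]_q = [t]_q · [K]_{q^t}, the q-integer [t]_q divides [N]_q whenever t ∣ N; so replacing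
-- an entry of a vertex by a multiple of it keeps the quotient a polynomial with nonnegative
-- coefficients, and the result is again a vertex.  Let N be the product of all entries of two
-- vertices A and A'.  Replacing the entries of A by N one at a time walks from A to (N, …, N) in at
-- most m steps, and likewise for A'; the two walks together join A to A' in at most 2m steps.
-- B itself is a vertex, so the graph is nonempty.

open import Defs
open import Algebra.Bundles using (CommutativeMonoid)
open import Algebra.Definitions using (Associative; Commutative; LeftIdentity; Congruent₂)
open import Algebra.Structures.Biased using (isCommutativeMonoidˡ)
open import Data.List using (List; []; _∷_; _++_; _∷ʳ_; replicate; length)
open import Data.List.Properties using (length-++; ∷ʳ-++)
open import Data.List.Relation.Binary.Permutation.Propositional using (_↭_; ↭-refl; ↭-sym; ↭-trans)
open import Data.List.Relation.Binary.Permutation.Propositional.Properties using () renaming (shift to ↭-shift)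
open import Data.List.Relation.Unary.All as All using (All; []; _∷_)
open import Data.List.Relation.Unary.All.Properties using (++⁺; ++⁻)
open import Data.Nat using (ℕ; zero; suc; _+_; _*_; _≤_; _<_; _≟_; z≤n; >-nonZero; >-nonZero⁻¹)
open import Data.Nat.Divisibility using (_∣_; divides)
open import Data.Nat.ListAction using (product)
open import Data.Nat.ListAction.Properties using (∈⇒∣product; product≢0)
open import Data.Nat.Properties
open import Data.Nat.Tactic.RingSolver using (solve-∀)
open import Data.Product using (Σ; ∃-syntax; _×_; _,_)
open import Function using (const)
open import Level using (0ℓ)
open import Relation.Binary.Structures using (IsEquivalence)
open import Relation.Binary.PropositionalEquality
open import Relation.Nullary using (yes; no)

Seq : Set
Seq = ℕ → ℕ

tail : Seq → Seq
tail f i = f (suc i)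

infixl 7 _⋆_

-- Cauchy product, unfolded as f ⋆ g = f 0 · g + q · (tail f ⋆ g) to mirror _*ₚ_.
_⋆_ : Seq → Seq → Seq
(f ⋆ g) zero    = f 0 * g 0
(f ⋆ g) (suc k) = f 0 * g (suc k) + (tail f ⋆ g) k

shift₁ : Seq → Seq
shift₁ g zero    = 0
shift₁ g (suc k) = g k

shift : ℕ → Seq → Seq
shift zero    g = g
shift (suc n) g = shift₁ (shift n g)

⋆-cong : ∀ {f f′ g g′} → f ≗ f′ → g ≗ g′ → f ⋆ g ≗ f′ ⋆ g′
⋆-cong f≗f′ g≗g′ zero    = cong₂ _*_ (f≗f′ 0) (g≗g′ 0)
⋆-cong f≗f′ g≗g′ (suc k) =
  cong₂ _+_ (cong₂ _*_ (f≗f′ 0) (g≗g′ (suc k))) (⋆-cong (λ i → f≗f′ (suc i)) g≗g′ k)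

⋆-zeroˡ : ∀ g → const 0 ⋆ g ≗ const 0
⋆-zeroˡ g zero    = refl
⋆-zeroˡ g (suc k) = ⋆-zeroˡ g k

⋆-identityˡ : ∀ g → coeff (1 ∷ []) ⋆ g ≗ g
⋆-identityˡ g zero    = *-identityˡ (g 0)
⋆-identityˡ g (suc k) = trans (cong₂ _+_ (*-identityˡ (g (suc k))) (⋆-zeroˡ g k)) (+-identityʳ (g (suc k)))

⋆-linearˡ : ∀ a f g h → (λ i → a * f i + g i) ⋆ h ≗ λ k → a * (f ⋆ h) k + (g ⋆ h) k
⋆-linearˡ a f g h zero    = distrib a (f 0) (g 0) (h 0)
  where
  distrib : ∀ a x y z → (a * x + y) * z ≡ a * (x * z) + y * z
  distrib = solve-∀
⋆-linearˡ a f g h (suc k) =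
  trans (cong ((a * f 0 + g 0) * h (suc k) +_) (⋆-linearˡ a (tail f) (tail g) h k))
        (distrib a (f 0) (g 0) (h (suc k)) ((tail f ⋆ h) k) ((tail g ⋆ h) k))
  where
  distrib : ∀ a x y z u v → (a * x + y) * z + (a * u + v) ≡ a * (x * z + u) + (y * z + v)
  distrib = solve-∀

⋆-distribˡ : ∀ f g h → f ⋆ (λ i → g i + h i) ≗ λ k → (f ⋆ g) k + (f ⋆ h) k
⋆-distribˡ f g h zero    = *-distribˡ-+ (f 0) (g 0) (h 0)
⋆-distribˡ f g h (suc k) =
  trans (cong (f 0 * (g (suc k) + h (suc k)) +_) (⋆-distribˡ (tail f) g h k))
        (distrib (f 0) (g (suc k)) (h (suc k)) ((tail f ⋆ g) k) ((tail f ⋆ h) k))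
  where
  distrib : ∀ x y z u v → x * (y + z) + (u + v) ≡ (x * y + u) + (x * z + v)
  distrib = solve-∀

-- tail (f ⋆ g) unfolds definitionally to f 0 · tail g + tail f ⋆ g, which ⋆-linearˡ distributes over h.
⋆-assoc : ∀ f g h → (f ⋆ g) ⋆ h ≗ f ⋆ (g ⋆ h)
⋆-assoc f g h zero    = *-assoc (f 0) (g 0) (h 0)
⋆-assoc f g h (suc k) = begin
  f 0 * g 0 * h (suc k) + ((λ i → f 0 * g (suc i) + (tail f ⋆ g) i) ⋆ h) k
    ≡⟨ cong (f 0 * g 0 * h (suc k) +_) (⋆-linearˡ (f 0) (tail g) (tail f ⋆ g) h k) ⟩
  f 0 * g 0 * h (suc k) + (f 0 * (tail g ⋆ h) k + ((tail f ⋆ g) ⋆ h) k)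
    ≡⟨ cong (λ x → f 0 * g 0 * h (suc k) + (f 0 * (tail g ⋆ h) k + x)) (⋆-assoc (tail f) g h k) ⟩
  f 0 * g 0 * h (suc k) + (f 0 * (tail g ⋆ h) k + (tail f ⋆ (g ⋆ h)) k)
    ≡⟨ regroup (f 0) (g 0) (h (suc k)) ((tail g ⋆ h) k) ((tail f ⋆ (g ⋆ h)) k) ⟩
  f 0 * (g 0 * h (suc k) + (tail g ⋆ h) k) + (tail f ⋆ (g ⋆ h)) k ∎
  where
  open ≡-Reasoning
  regroup : ∀ x y z u v → x * y * z + (x * u + v) ≡ x * (y * z + u) + v
  regroup = solve-∀

⋆-unfoldʳ : ∀ f g k → (f ⋆ g) (suc k) ≡ f (suc k) * g 0 + (f ⋆ tail g) k
⋆-unfoldʳ f g zero    = +-comm (f 0 * g 1) (f 1 * g 0)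
⋆-unfoldʳ f g (suc k) =
  trans (cong (f 0 * g (suc (suc k)) +_) (⋆-unfoldʳ (tail f) g k))
        (exchange (f 0 * g (suc (suc k))) (f (suc (suc k)) * g 0) ((tail f ⋆ tail g) k))
  where
  exchange : ∀ x y z → x + (y + z) ≡ y + (x + z)
  exchange = solve-∀

⋆-comm : ∀ f g → f ⋆ g ≗ g ⋆ f
⋆-comm f g zero    = *-comm (f 0) (g 0)
⋆-comm f g (suc k) =
  trans (cong₂ _+_ (*-comm (f 0) (g (suc k))) (⋆-comm (tail f) g k)) (sym (⋆-unfoldʳ g f k))

⋆-identityʳ : ∀ f → f ⋆ coeff (1 ∷ []) ≗ f
⋆-identityʳ f k = trans (⋆-comm f (coeff (1 ∷ [])) k) (⋆-identityˡ f k)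

shift₁-cong : ∀ {g h} → g ≗ h → shift₁ g ≗ shift₁ h
shift₁-cong g≗h zero    = refl
shift₁-cong g≗h (suc k) = g≗h k

shift-cong : ∀ n {g h} → g ≗ h → shift n g ≗ shift n h
shift-cong zero    g≗h = g≗h
shift-cong (suc n) g≗h = shift₁-cong (shift-cong n g≗h)

⋆-shift₁ : ∀ f g → f ⋆ shift₁ g ≗ shift₁ (f ⋆ g)
⋆-shift₁ f g zero          = *-zeroʳ (f 0)
⋆-shift₁ f g (suc zero)    = trans (cong (f 0 * g 0 +_) (⋆-shift₁ (tail f) g 0)) (+-identityʳ _)
⋆-shift₁ f g (suc (suc k)) = cong (f 0 * g (suc k) +_) (⋆-shift₁ (tail f) g (suc k))

⋆-shift : ∀ n f g → f ⋆ shift n g ≗ shift n (f ⋆ g)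
⋆-shift zero    f g k = refl
⋆-shift (suc n) f g k = trans (⋆-shift₁ f (shift n g) k) (shift₁-cong (⋆-shift n f g) k)

coeff-+ₚ : ∀ p q → coeff (p +ₚ q) ≗ λ k → coeff p k + coeff q k
coeff-+ₚ []      q       k       = refl
coeff-+ₚ (a ∷ p) []      zero    = sym (+-identityʳ a)
coeff-+ₚ (a ∷ p) []      (suc k) = sym (+-identityʳ (coeff p k))
coeff-+ₚ (a ∷ p) (b ∷ q) zero    = refl
coeff-+ₚ (a ∷ p) (b ∷ q) (suc k) = coeff-+ₚ p q k

coeff-scale : ∀ a p → coeff (scale a p) ≗ λ k → a * coeff p k
coeff-scale a []      k       = sym (*-zeroʳ a)
coeff-scale a (b ∷ p) zero    = refl
coeff-scale a (b ∷ p) (suc k) = coeff-scale a p k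

coeff-*ₚ : ∀ p q → coeff (p *ₚ q) ≗ coeff p ⋆ coeff q
coeff-*ₚ []      q k       = sym (⋆-zeroˡ (coeff q) k)
coeff-*ₚ (a ∷ p) q zero    =
  trans (coeff-+ₚ (scale a q) (0 ∷ p *ₚ q) 0) (trans (+-identityʳ _) (coeff-scale a q 0))
coeff-*ₚ (a ∷ p) q (suc k) =
  trans (coeff-+ₚ (scale a q) (0 ∷ p *ₚ q) (suc k)) (cong₂ _+_ (coeff-scale a q (suc k)) (coeff-*ₚ p q k))

infix 4 _≋_

-- _≈ₚ_ wrapped in a record, so that unification can recover both polynomials from an equation.
record _≋_ (p q : Poly) : Set where
  constructor coeffwise
  field coeff-≡ : p ≈ₚ q

open _≋_ using (coeff-≡)

≋-isEquivalence : IsEquivalence _≋_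
≋-isEquivalence = record
  { refl  = coeffwise λ k → refl
  ; sym   = λ (coeffwise p≈q) → coeffwise λ k → sym (p≈q k)
  ; trans = λ (coeffwise p≈q) (coeffwise q≈r) → coeffwise λ k → trans (p≈q k) (q≈r k)
  }

*ₚ-cong : Congruent₂ _≋_ _*ₚ_
*ₚ-cong {p} {p′} {q} {q′} (coeffwise p≈p′) (coeffwise q≈q′) = coeffwise λ k →
  trans (coeff-*ₚ p q k) (trans (⋆-cong p≈p′ q≈q′ k) (sym (coeff-*ₚ p′ q′ k)))

*ₚ-assoc : Associative _≋_ _*ₚ_
*ₚ-assoc p q r = coeffwise λ k → begin
  coeff ((p *ₚ q) *ₚ r) k               ≡⟨ coeff-*ₚ (p *ₚ q) r k ⟩
  (coeff (p *ₚ q) ⋆ coeff r) k          ≡⟨ ⋆-cong (coeff-*ₚ p q) (λ _ → refl) k ⟩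
  (coeff p ⋆ coeff q ⋆ coeff r) k       ≡⟨ ⋆-assoc (coeff p) (coeff q) (coeff r) k ⟩
  (coeff p ⋆ (coeff q ⋆ coeff r)) k     ≡⟨ ⋆-cong (λ _ → refl) (coeff-*ₚ q r) k ⟨
  (coeff p ⋆ coeff (q *ₚ r)) k          ≡⟨ coeff-*ₚ p (q *ₚ r) k ⟨
  coeff (p *ₚ (q *ₚ r)) k               ∎
  where open ≡-Reasoning

*ₚ-comm : Commutative _≋_ _*ₚ_
*ₚ-comm p q = coeffwise λ k →
  trans (coeff-*ₚ p q k) (trans (⋆-comm (coeff p) (coeff q) k) (sym (coeff-*ₚ q p k)))

*ₚ-identityˡ : LeftIdentity _≋_ (1 ∷ []) _*ₚ_
*ₚ-identityˡ p = coeffwise λ k → trans (coeff-*ₚ (1 ∷ []) p k) (⋆-identityˡ (coeff p) k)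

*ₚ-commutativeMonoid : CommutativeMonoid 0ℓ 0ℓ
*ₚ-commutativeMonoid = record
  { ε                   = 1 ∷ []
  ; isCommutativeMonoid = isCommutativeMonoidˡ record
    { isSemigroup = record
      { isMagma = record { isEquivalence = ≋-isEquivalence ; ∙-cong = *ₚ-cong }
      ; assoc   = *ₚ-assoc
      }
    ; identityˡ = *ₚ-identityˡ
    ; comm      = *ₚ-comm
    }
  }

open CommutativeMonoid *ₚ-commutativeMonoid using (semigroup; rawMagma; ∙-congˡ; assoc; comm; identityʳ)
  renaming (sym to ≋-sym; trans to ≋-trans)
open import Algebra.Definitions.RawMagma rawMagma using (_∣ˡ_; _,_)
open import Algebra.Properties.Semigroup.Divisibility semigroup
  using (∣ˡ-trans; x∣ˡy⇒zx∣ˡzy; ∣ˡ-respˡ-≈; ∣ˡ-respʳ-≈)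

coeff-qint-+ : ∀ m n → coeff (qint (m + n)) ≗ λ k → coeff (qint m) k + shift m (coeff (qint n)) k
coeff-qint-+ zero    n k       = refl
coeff-qint-+ (suc m) n zero    = refl
coeff-qint-+ (suc m) n (suc k) = coeff-qint-+ m n k

coeff-padding : ∀ n p → coeff (replicate n 0 ++ p) ≗ shift n (coeff p)
coeff-padding zero    p k       = refl
coeff-padding (suc n) p zero    = refl
coeff-padding (suc n) p (suc k) = coeff-padding n p k

-- [K]_{q^t} = 1 + q^t + q^{2t} + ⋯ + q^{(K-1)t}
qint-pow : ℕ → ℕ → Poly
qint-pow t zero    = []
qint-pow t (suc K) = (1 ∷ []) +ₚ (replicate t 0 ++ qint-pow t K)

qint-*-factor : ∀ K t → qint (K * t) ≈ₚ (qint t *ₚ qint-pow t K)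
qint-*-factor zero    t k = sym (coeff-≡ (*ₚ-comm (qint t) []) k)
qint-*-factor (suc K) t k = begin
  coeff (qint (t + K * t)) k
    ≡⟨ coeff-qint-+ t (K * t) k ⟩
  [t] k + shift t (coeff (qint (K * t))) k
    ≡⟨ cong₂ _+_ (⋆-identityʳ [t] k) (shift-cong t (λ i → sym (qint-*-factor K t i)) k) ⟨
  ([t] ⋆ coeff (1 ∷ [])) k + shift t (coeff (qint t *ₚ qint-pow t K)) k
    ≡⟨ cong ((([t] ⋆ coeff (1 ∷ [])) k) +_) (shift-cong t (coeff-*ₚ (qint t) (qint-pow t K)) k) ⟩
  ([t] ⋆ coeff (1 ∷ [])) k + shift t ([t] ⋆ coeff (qint-pow t K)) k
    ≡⟨ cong ((([t] ⋆ coeff (1 ∷ [])) k) +_) (⋆-shift t [t] (coeff (qint-pow t K)) k) ⟨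
  ([t] ⋆ coeff (1 ∷ [])) k + ([t] ⋆ shift t (coeff (qint-pow t K))) k
    ≡⟨ ⋆-distribˡ [t] (coeff (1 ∷ [])) (shift t (coeff (qint-pow t K))) k ⟨
  ([t] ⋆ (λ i → coeff (1 ∷ []) i + shift t (coeff (qint-pow t K)) i)) k
    ≡⟨ ⋆-cong (λ _ → refl) unfold k ⟨
  ([t] ⋆ coeff (qint-pow t (suc K))) k
    ≡⟨ coeff-*ₚ (qint t) (qint-pow t (suc K)) k ⟨
  coeff (qint t *ₚ qint-pow t (suc K)) k ∎
  where
  open ≡-Reasoning
  [t] = coeff (qint t)
  unfold : coeff (qint-pow t (suc K)) ≗ λ i → coeff (1 ∷ []) i + shift t (coeff (qint-pow t K)) i
  unfold i = trans (coeff-+ₚ (1 ∷ []) (replicate t 0 ++ qint-pow t K) i)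
                   (cong (coeff (1 ∷ []) i +_) (coeff-padding t (qint-pow t K) i))

qint-∣ˡ : ∀ {t N} → t ∣ N → qint t ∣ˡ qint N
qint-∣ˡ {t} (divides K refl) = qint-pow t K , coeffwise λ k → sym (qint-*-factor K t k)

qprod-insert : ∀ R x T → qprod (R ++ x ∷ T) ≋ qprod (R ++ T) *ₚ qint x
qprod-insert []      x T = comm (qint x) (qprod T)
qprod-insert (r ∷ R) x T =
  ≋-trans (∙-congˡ {qint r} (qprod-insert R x T)) (≋-sym (assoc (qint r) (qprod (R ++ T)) (qint x)))

qprod-replace-∣ˡ : ∀ R T {t N} → t ∣ N → qprod (R ++ t ∷ T) ∣ˡ qprod (R ++ N ∷ T)
qprod-replace-∣ˡ R T {t} {N} t∣N =
  ∣ˡ-respʳ-≈ (≋-sym (qprod-insert R N T))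
    (∣ˡ-respˡ-≈ (≋-sym (qprod-insert R t T)) (x∣ˡy⇒zx∣ˡzy (qprod (R ++ T)) (qint-∣ˡ t∣N)))

isBCGF-replace : ∀ B R T {t N} → t ∣ N → IsBCGF (R ++ t ∷ T) B → IsBCGF (R ++ N ∷ T) B
isBCGF-replace B R T t∣N (c , B∣) =
  let c′ , coeffwise B∣′ = ∣ˡ-trans {qprod B} (c , coeffwise B∣) (qprod-replace-∣ˡ R T t∣N)
  in c′ , B∣′

vertex-replace : ∀ B R T {t N} → 0 < N → t ∣ N → Vertex B (R ++ t ∷ T) → Vertex B (R ++ N ∷ T)
vertex-replace B R T 0<N t∣N (A⁺ , |A| , bcgf) =
  let R⁺ , tT⁺ = ++⁻ R A⁺
  in ++⁺ R⁺ (0<N ∷ All.tail tT⁺) ,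
     trans (length-++ R) (trans (sym (length-++ R)) |A|) ,
     isBCGF-replace B R T t∣N bcgf

vertex-self : ∀ {B} → Positive B → Vertex B B
vertex-self {B} B⁺ = B⁺ , refl , 1 ∷ [] , coeff-≡ (identityʳ (qprod B))

adjacent-replace : ∀ R T {t N} → t ≢ N → Adjacent (R ++ t ∷ T) (R ++ N ∷ T)
adjacent-replace R T {t} {N} t≢N = t , N , R ++ T , t≢N , ↭-shift t R T , ↭-shift N R T

adjacent-sym : ∀ {X Y} → Adjacent X Y → Adjacent Y X
adjacent-sym (x , y , rest , x≢y , X↭ , Y↭) = y , x , rest , (λ y≡x → x≢y (sym y≡x)) , Y↭ , X↭

adjacent-respˡ-↭ : ∀ {X Y Z} → X ↭ Y → Adjacent Y Z → Adjacent X Z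
adjacent-respˡ-↭ X↭Y (x , y , rest , x≢y , Y↭ , Z↭) = x , y , rest , x≢y , ↭-trans X↭Y Y↭ , Z↭

path-respˡ-↭ : ∀ {B X Y Z n} → X ↭ Y → Path B Y Z n → Path B X Z n
path-respˡ-↭ X↭Y (stay Y↭Z)      = stay (↭-trans X↭Y Y↭Z)
path-respˡ-↭ X↭Y (step adj v p) = step (adjacent-respˡ-↭ X↭Y adj) v p

path-++ : ∀ {B X Y Z m n} → Path B X Y m → Path B Y Z n → Path B X Z (m + n)
path-++ (stay X↭Y)     q = path-respˡ-↭ X↭Y q
path-++ (step adj v p) q = step adj v (path-++ p q)

path-reverse : ∀ {B X Y n} → Vertex B X → Path B X Y n → Path B Y X n
path-reverse vX (stay X↭Y) = stay (↭-sym X↭Y)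
path-reverse {B} {X} {Y} {suc n} vX (step adj v p) =
  subst (Path B Y X) (+-comm n 1) (path-++ (path-reverse v p) (step (adjacent-sym adj) vX (stay ↭-refl)))

path-replace : ∀ B R T {t N} → 0 < N → t ∣ N → Vertex B (R ++ t ∷ T) →
  ∃[ n ] n ≤ 1 × Path B (R ++ t ∷ T) (R ++ N ∷ T) n
path-replace B R T {t} {N} 0<N t∣N v with t ≟ N
... | yes refl = 0 , z≤n , stay ↭-refl
... | no t≢N   = 1 , ≤-refl , step (adjacent-replace R T t≢N) (vertex-replace B R T 0<N t∣N v) (stay ↭-refl)

path-to-replicate : ∀ B {N} R T → 0 < N → All (_∣ N) T → Vertex B (R ++ T) →
  ∃[ n ] n ≤ length T × Path B (R ++ T) (R ++ replicate (length T) N) n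
path-to-replicate B R []      0<N []            v = 0 , z≤n , stay ↭-refl
path-to-replicate B {N} R (t ∷ T) 0<N (t∣N ∷ T∣N) v =
  let n₁ , n₁≤1 , p₁ = path-replace B R T 0<N t∣N v
      v′             = subst (Vertex B) (sym (∷ʳ-++ R N T)) (vertex-replace B R T 0<N t∣N v)
      n₂ , n₂≤ , p₂  = path-to-replicate B (R ∷ʳ N) T 0<N T∣N v′
  in n₁ + n₂ , +-mono-≤ n₁≤1 n₂≤ ,
     path-++ p₁ (subst₂ (λ X Y → Path B X Y n₂) (∷ʳ-++ R N T) (∷ʳ-++ R N _) p₂)

product-pos : ∀ {ns} → Positive ns → 0 < product ns
product-pos ns⁺ = >-nonZero⁻¹ _ {{product≢0 (All.map >-nonZero ns⁺)}}

all-∣-product : ∀ ns → All (_∣ product ns) ns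
all-∣-product ns = All.tabulate ∈⇒∣product

path-≤-2*length : ∀ {B} A A′ → Vertex B A → Vertex B A′ → ∃[ n ] n ≤ 2 * length B × Path B A A′ n
path-≤-2*length {B} A A′ vA@(A⁺ , |A| , _) vA′@(A′⁺ , |A′| , _) =
  let A∣N , A′∣N    = ++⁻ A (all-∣-product (A ++ A′))
      n₁ , n₁≤ , p₁ = path-to-replicate B [] A 0<N A∣N vA
      n₂ , n₂≤ , p₂ = path-to-replicate B [] A′ 0<N A′∣N vA′
  in n₁ + n₂ ,
     subst (n₁ + n₂ ≤_) (cong (length B +_) (sym (+-identityʳ (length B))))
       (+-mono-≤ (subst (n₁ ≤_) |A| n₁≤) (subst (n₂ ≤_) |A′| n₂≤)) ,
     path-++ (to-Nᵐ |A| p₁) (path-reverse vA′ (to-Nᵐ |A′| p₂))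
  where
  N = product (A ++ A′)
  0<N = product-pos (++⁺ A⁺ A′⁺)
  to-Nᵐ : ∀ {X n} → length X ≡ length B → Path B X (replicate (length X) N) n → Path B X (replicate (length B) N) n
  to-Nᵐ {X} {n} |X| = subst (λ m → Path B X (replicate m N) n) |X|

corollary3p15 : (B : List ℕ) → Positive B →
    (Σ (List ℕ) λ A → Vertex B A)
    × ((A A' : List ℕ) → Vertex B A → Vertex B A' → Σ ℕ λ n → Path B A A' n)
    × ((A A' : List ℕ) → Vertex B A → Vertex B A' →
        Σ ℕ λ n → n ≤ 2 * length B × Path B A A' n)
corollary3p15 B B⁺ =
  (B , vertex-self B⁺) ,
  (λ A A′ vA vA′ → let n , _ , p = path-≤-2*length A A′ vA vA′ in n , p) ,
  path-≤-2*length
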